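{- Let $n$ be a positive integer and let $\delta_2,\gamma_2$ be as defined in the context. The set $\mathcal{C}_n(\delta_2,\gamma_2)$ equals the set of coloured partitions $\lambda_1+\dots+\lambda_s$, each part coloured by some $a_ib_k$ with $0\le i,k\le n-1$ and $(i,k)\ne(0,0)$, such that $\lambda_j-\lambda_{j+1}\ge\Delta_2(c(\lambda_j),c(\lambda_{j+1}))$ for all $j\in\{1,\dots,s-1\}$, where $\Delta_2(a_ib_i,a_ib_i)=1$ for all $i>0$; $\Delta_2(a_kb_k,a_kb_\ell)=1$ for all $k>\ell\ge0$; $\Delta_2(a_kb_\ell,a_\ell b_\ell)=1$ for all $\ell>k\ge0$; and $\Delta_2(c_1,c_2)=\Delta(c_1,c_2)$ otherwise; and which, for every positive integer $p$, avoid the patterns $(p+1)_{a_{k_1}b_{\ell_1}}+p_{a_{\ell_2+1}b_{\ell_2+1}}+p_{a_{k_2}b_{\ell_2}}$ for all $k_1\ge k_2>\ell_1>\ell_2$, and $(p+1)_{a_{k_1}b_{\ell_1}}+(p+1)_{a_{k_1+1}b_{k_1+1}}+p_{a_{k_2}b_{\ell_2}}$ for all $\ell_2\ge\ell_1>k_2>k_1$.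
   Context: Colours are symbols $a_ib_k$ with $0\le i,k\le n-1$; $a_ib_i$ is free, $a_ib_k$ ($i\ne k$) bound. With $\chi(P)\in\{0,1\}$ the truth value of $P$, $\Delta(a_ib_k,a_{i'}b_{k'})=\chi(i\ge i')-\chi(i=k=i')+\chi(k\le k')-\chi(k=i'=k')$. $\mathcal{P}_n$ is the set of coloured partitions $\lambda_1+\dots+\lambda_s$ (positive integer parts, colours $c(\lambda_j)$) with $\lambda_j-\lambda_{j+1}\ge\Delta(c(\lambda_j),c(\lambda_{j+1}))$. Write $p_c$ for a part $p$ of colour $c$; $\lambda$ contains the pattern $\pi_1+\dots+\pi_r$ if $\lambda_i=\pi_1,\dots,\lambda_{i+r-1}=\pi_r$ (as coloured parts) for some $i$. For given functions $\delta$ (on bound colours) and $\gamma$ (on pairs of bound colours), $\mathcal{C}_n(\delta,\gamma)$ is the set of $\lambda\in\mathcal{P}_n$ with no part coloured $a_0b_0$ avoiding, for every positive integer $p$: (a) $p_{a_ib_i}+p_{a_ib_i}$, $1\le i\le n-1$; (b) $p_{a_{k_1}b_{\ell_1}}+p_{a_ib_i}+p_{a_{k_2}b_{\ell_2}}$ when $\max\{k_1,\ell_2\}<\min\{k_2,\ell_1\}$, $i=\gamma(a_{k_1}b_{\ell_1},a_{k_2}b_{\ell_2})$; (c) for $k_2>\ell_2$: (c1) $(p+u)_{a_{k_1}b_{\ell_1}}+p_{a_ib_i}+p_{a_{k_2}b_{\ell_2}}$ for any $2\le u\le\infty$, any $k_1,\ell_1$, $i=\delta(a_{k_2}b_{\ell_2})$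 ($u=\infty$ meaning $p_{a_ib_i}+p_{a_{k_2}b_{\ell_2}}$ begins the partition); (c2) $(p+1)_{a_{k_1}b_{\ell_1}}+p_{a_ib_i}+p_{a_{k_2}b_{\ell_2}}$ for $k_1\le\ell_1$, $i=\delta(a_{k_2}b_{\ell_2})$; (c3) the same pattern for $k_1>\ell_1$ with $\{\ell_2+1,\dots,k_2\}\setminus\{\ell_1+1,\dots,k_1\}\ne\emptyset$, $i=\gamma(a_{k_1}b_{\ell_1},a_{k_2}b_{\ell_2})$; (d) for $k_1<\ell_1$: (d1) $p_{a_{k_1}b_{\ell_1}}+p_{a_ib_i}+(p-u)_{a_{k_2}b_{\ell_2}}$ for any $2\le u\le\infty$, any $k_2,\ell_2$, $i=\delta(a_{k_1}b_{\ell_1})$ ($u=\infty$ meaning $p_{a_{k_1}b_{\ell_1}}+p_{a_ib_i}$ ends the partition); (d2) $(p+1)_{a_{k_1}b_{\ell_1}}+(p+1)_{a_ib_i}+p_{a_{k_2}b_{\ell_2}}$ for $k_2\ge\ell_2$, $i=\delta(a_{k_1}b_{\ell_1})$; (d3) the same pattern for $k_2<\ell_2$ with $\{k_1+1,\dots,\ell_1\}\setminus\{k_2+1,\dots,\ell_2\}\ne\emptyset$, $i=\gamma(a_{k_1}b_{\ell_1},a_{k_2}b_{\ell_2})$. Here $\delta_2(a_kb_\ell)=\max\{k,\ell\}$ for $k\ne\ell$, and $\gamma_2$ is defined by: for $\max\{k_1,\ell_2\}<\min\{k_2,\ell_1\}$, $\gamma_2(a_{k_1}b_{\ell_1},a_{k_2}b_{\ell_2})=\min\{k_2,\ell_1\}$;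 for $k_1>\ell_1$, $k_2>\ell_2$ with $D:=\{\ell_2+1,\dots,k_2\}\setminus\{\ell_1+1,\dots,k_1\}\ne\emptyset$, $\gamma_2=k_2$ if $k_2\in D$ and $\ell_2+1$ otherwise; for $k_1<\ell_1$, $k_2<\ell_2$ with $E:=\{k_1+1,\dots,\ell_1\}\setminus\{k_2+1,\dots,\ell_2\}\ne\emptyset$, $\gamma_2=\ell_1$ if $\ell_1\in E$ and $k_1+1$ otherwise. -}

module Defs where

open import Data.Nat using (ℕ; zero; suc; _+_; _∸_; _≤_; _<_; _⊔_; _⊓_; _≡ᵇ_; _<ᵇ_; _≤ᵇ_)
open import Data.Bool using (Bool; true; false; if_then_else_; _∧_; not)
open import Data.Product using (_×_; _,_; proj₁; proj₂; ∃-syntax)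
open import Data.List using (List; []; _∷_; _++_)
open import Data.List.Relation.Unary.All using (All)
open import Data.List.Relation.Unary.Linked using (Linked)
open import Relation.Binary.PropositionalEquality using (_≡_)
open import Relation.Nullary using (¬_)

-- Colours a_i b_k are represented by pairs (i , k) of naturals.
-- The bound 0 ≤ i,k ≤ n-1 is imposed on the parts of a partition.

Colour : Set
Colour = ℕ × ℕ

Part : Set
Part = ℕ × Colour

size : Part → ℕ
size = proj₁

col : Part → Colour
col = proj₂

χ : Bool → ℕ
χ true  = 1
χ false = 0

-- Δ(a_i b_k , a_i' b_k') =
--   χ(i ≥ i') - χ(i = k = i') + χ(k ≤ k') - χ(k = i' = k').
-- Each difference is of the form χ(P) - χ(Q) with Q ⇒ P, hence is
-- non-negative and truncated subtraction on ℕ computes it exactly.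
Δ : Colour → Colour → ℕ
Δ (i , k) (i' , k') =
  (χ (i' ≤ᵇ i) ∸ χ ((i ≡ᵇ k) ∧ (k ≡ᵇ i')))
  + (χ (k ≤ᵇ k') ∸ χ ((k ≡ᵇ i') ∧ (i' ≡ᵇ k')))

DiffCond : (Colour → Colour → ℕ) → Part → Part → Set
DiffCond D x y = size y + D (col x) (col y) ≤ size x

ValidPart : ℕ → Part → Set
ValidPart n (p , (i , k)) = 1 ≤ p × i < n × k < n

InP : ℕ → List Part → Set
InP n λs = All (ValidPart n) λs × Linked (DiffCond Δ) λs

Contains : List Part → List Part → Set
Contains λs π = ∃[ xs ] ∃[ ys ] (λs ≡ xs ++ (π ++ ys))

BeginsWith : List Part → List Part → Set
BeginsWith λs π = ∃[ ys ] (λs ≡ π ++ ys)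

EndsWith : List Part → List Part → Set
EndsWith λs π = ∃[ xs ] (λs ≡ xs ++ π)

free : ℕ → Colour
free i = (i , i)

NotZeroZero : Part → Set
NotZeroZero (_ , (i , k)) = ¬ (i ≡ 0 × k ≡ 0)

DNonEmpty : ℕ → ℕ → ℕ → ℕ → Set
DNonEmpty k₁ ℓ₁ k₂ ℓ₂ = ∃[ j ] (ℓ₂ < j × j ≤ k₂ × ¬ (ℓ₁ < j × j ≤ k₁))

ENonEmpty : ℕ → ℕ → ℕ → ℕ → Set
ENonEmpty k₁ ℓ₁ k₂ ℓ₂ = ∃[ j ] (k₁ < j × j ≤ ℓ₁ × ¬ (k₂ < j × j ≤ ℓ₂))

module _ (n : ℕ) (δ : Colour → ℕ) (γ : Colour → Colour → ℕ) (λs : List Part) where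

  AvoidA : Set
  AvoidA = ∀ p i → 1 ≤ p → 1 ≤ i → i < n →
    ¬ Contains λs ((p , free i) ∷ (p , free i) ∷ [])

  AvoidB : Set
  AvoidB = ∀ p k₁ ℓ₁ k₂ ℓ₂ → 1 ≤ p → k₁ ⊔ ℓ₂ < k₂ ⊓ ℓ₁ →
    ¬ Contains λs ((p , (k₁ , ℓ₁)) ∷ (p , free (γ (k₁ , ℓ₁) (k₂ , ℓ₂)))
                    ∷ (p , (k₂ , ℓ₂)) ∷ [])

  AvoidC1 : Set
  AvoidC1 = ∀ p k₂ ℓ₂ → 1 ≤ p → ℓ₂ < k₂ →
    (∀ u k₁ ℓ₁ → 2 ≤ u →
      ¬ Contains λs ((p + u , (k₁ , ℓ₁)) ∷ (p , free (δ (k₂ , ℓ₂)))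
                      ∷ (p , (k₂ , ℓ₂)) ∷ []))
    × ¬ BeginsWith λs ((p , free (δ (k₂ , ℓ₂))) ∷ (p , (k₂ , ℓ₂)) ∷ [])

  AvoidC2 : Set
  AvoidC2 = ∀ p k₁ ℓ₁ k₂ ℓ₂ → 1 ≤ p → ℓ₂ < k₂ → k₁ ≤ ℓ₁ →
    ¬ Contains λs ((p + 1 , (k₁ , ℓ₁)) ∷ (p , free (δ (k₂ , ℓ₂)))
                    ∷ (p , (k₂ , ℓ₂)) ∷ [])

  AvoidC3 : Set
  AvoidC3 = ∀ p k₁ ℓ₁ k₂ ℓ₂ → 1 ≤ p → ℓ₂ < k₂ → ℓ₁ < k₁ →
    DNonEmpty k₁ ℓ₁ k₂ ℓ₂ →
    ¬ Contains λs ((p + 1 , (k₁ , ℓ₁)) ∷ (p , free (γ (k₁ , ℓ₁) (k₂ , ℓ₂)))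
                    ∷ (p , (k₂ , ℓ₂)) ∷ [])

  -- (d1): the last part has size p - u with u ≥ 2, written q with q + u = p
  AvoidD1 : Set
  AvoidD1 = ∀ p k₁ ℓ₁ → 1 ≤ p → k₁ < ℓ₁ →
    (∀ u q k₂ ℓ₂ → 2 ≤ u → q + u ≡ p →
      ¬ Contains λs ((p , (k₁ , ℓ₁)) ∷ (p , free (δ (k₁ , ℓ₁)))
                      ∷ (q , (k₂ , ℓ₂)) ∷ []))
    × ¬ EndsWith λs ((p , (k₁ , ℓ₁)) ∷ (p , free (δ (k₁ , ℓ₁))) ∷ [])

  AvoidD2 : Set
  AvoidD2 = ∀ p k₁ ℓ₁ k₂ ℓ₂ → 1 ≤ p → k₁ < ℓ₁ → ℓ₂ ≤ k₂ →
    ¬ Contains λs ((p + 1 , (k₁ , ℓ₁)) ∷ (p + 1 , free (δ (k₁ , ℓ₁)))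
                    ∷ (p , (k₂ , ℓ₂)) ∷ [])

  AvoidD3 : Set
  AvoidD3 = ∀ p k₁ ℓ₁ k₂ ℓ₂ → 1 ≤ p → k₁ < ℓ₁ → k₂ < ℓ₂ →
    ENonEmpty k₁ ℓ₁ k₂ ℓ₂ →
    ¬ Contains λs ((p + 1 , (k₁ , ℓ₁)) ∷ (p + 1 , free (γ (k₁ , ℓ₁) (k₂ , ℓ₂)))
                    ∷ (p , (k₂ , ℓ₂)) ∷ [])

  InC : Set
  InC = InP n λs × All NotZeroZero λs
      × AvoidA × AvoidB × AvoidC1 × AvoidC2 × AvoidC3
      × AvoidD1 × AvoidD2 × AvoidD3

δ₂ : Colour → ℕ
δ₂ (k , ℓ) = k ⊔ ℓ

-- γ₂; only its values on the three (disjoint) domains of the paper are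
-- ever used by 𝒞_n; elsewhere it returns the irrelevant default 0.
γ₂ : Colour → Colour → ℕ
γ₂ (k₁ , ℓ₁) (k₂ , ℓ₂) =
  if (k₁ ⊔ ℓ₂) <ᵇ (k₂ ⊓ ℓ₁) then k₂ ⊓ ℓ₁
  else if (ℓ₁ <ᵇ k₁) ∧ (ℓ₂ <ᵇ k₂) then
    -- k₂ ∈ D  iff  not (ℓ₁ < k₂ ≤ k₁)
    (if not ((ℓ₁ <ᵇ k₂) ∧ (k₂ ≤ᵇ k₁)) then k₂ else suc ℓ₂)
  else if (k₁ <ᵇ ℓ₁) ∧ (k₂ <ᵇ ℓ₂) then
    -- ℓ₁ ∈ E  iff  not (k₂ < ℓ₁ ≤ ℓ₂)
    (if not ((k₂ <ᵇ ℓ₁) ∧ (ℓ₁ ≤ᵇ ℓ₂)) then ℓ₁ else suc k₁)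
  else 0

Δ₂ : Colour → Colour → ℕ
Δ₂ (i , k) (i' , k') =
  if (i ≡ᵇ k) ∧ (i' ≡ᵇ i) ∧ (k' ≡ᵇ i) ∧ (0 <ᵇ i) then 1
  else if (i ≡ᵇ k) ∧ (i' ≡ᵇ k) ∧ (k' <ᵇ k) then 1
  else if (i' ≡ᵇ k') ∧ (k ≡ᵇ k') ∧ (i <ᵇ k) then 1
  else Δ (i , k) (i' , k')

InRHS : ℕ → List Part → Set
InRHS n λs =
  All (ValidPart n) λs × All NotZeroZero λs × Linked (DiffCond Δ₂) λs
  × (∀ p k₁ ℓ₁ k₂ ℓ₂ → 1 ≤ p → ℓ₂ < ℓ₁ → ℓ₁ < k₂ → k₂ ≤ k₁ →
      ¬ Contains λs ((p + 1 , (k₁ , ℓ₁)) ∷ (p , free (suc ℓ₂))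
                      ∷ (p , (k₂ , ℓ₂)) ∷ []))
  × (∀ p k₁ ℓ₁ k₂ ℓ₂ → 1 ≤ p → k₁ < k₂ → k₂ < ℓ₁ → ℓ₁ ≤ ℓ₂ →
      ¬ Contains λs ((p + 1 , (k₁ , ℓ₁)) ∷ (p + 1 , free (suc k₁))
                      ∷ (p , (k₂ , ℓ₂)) ∷ []))

module Submission where

-- Δ₂ differs from Δ only on the raised pairs of colours
--   (a_ib_i , a_ib_i) with i > 0,  (a_kb_k , a_kb_ℓ) with ℓ < k,  (a_kb_ℓ , a_ℓb_ℓ) with k < ℓ,
-- where Δ = 0 and Δ₂ = 1. So the Δ₂-difference condition is the Δ-condition together with
-- the absence of two consecutive equal parts whose colours form a raised pair.
--
-- Under the Δ₂-condition, every pattern forbidden in 𝒞_n(δ₂, γ₂) contains such an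
-- equal-size raised pair, except (c3) with k₂ ∉ D and (d3) with ℓ₁ ∉ E, where γ₂ takes the
-- values ℓ₂ + 1 and k₁ + 1: these are exactly the two patterns forbidden on the right.
--
-- Conversely, in a partition of 𝒞_n(δ₂, γ₂) an equal-size pair p_{a_kb_k} + p_{a_kb_ℓ}
-- (ℓ < k) is ruled out by the part q before it: for q = p the Δ-condition forces pattern (a)
-- or (b), for q = p + 1 pattern (c2) or (c3) with k₂ = k ∈ D, and for q ≥ p + 2 pattern (c1).
-- Symmetrically p_{a_kb_ℓ} + p_{a_ℓb_ℓ} (k < ℓ) is ruled out through the part after it and
-- (a), (b), (d1)-(d3), while p_{a_ib_i} + p_{a_ib_i} is pattern (a) itself.

open import Defs
open import Data.Bool using (Bool; true; false; T; _∧_)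
open import Data.Bool.Properties using (T-∧; T-≡)
open import Data.Empty using (⊥-elim)
open import Data.List using (List; []; _∷_; _++_; initLast; _∷ʳ′_)
open import Data.List.Properties using (++-assoc; ++-identityʳ)
open import Data.List.Relation.Unary.All using (All; _∷_)
open import Data.List.Relation.Unary.All.Properties using (++⁻ˡ; ++⁻ʳ)
open import Data.List.Relation.Unary.Linked as Linked using (Linked; []; [-]; _∷_)
open import Data.Nat using (ℕ; suc; _+_; _∸_; _≤_; _<_; _⊔_; _⊓_; _≡ᵇ_; _<ᵇ_; _≤ᵇ_; z≤n; s≤s; s≤s⁻¹; _≤?_; _<?_)
open import Data.Nat.Properties
open import Data.Product using (_×_; _,_; proj₁; proj₂; ∃-syntax)
open import Data.Sum using (_⊎_; inj₁; inj₂)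
open import Function using (_∘_)
open import Function.Bundles using (_⇔_; mk⇔; Equivalence)
open import Relation.Binary.PropositionalEquality using (_≡_; refl; sym; trans; cong; cong₂; subst)
open import Relation.Nullary using (¬_; yes; no)

open Equivalence using (to)

private
  variable
    i j k ℓ k₁ ℓ₁ k₂ ℓ₂ i′ k′ m n p q r u v w g g′ : ℕ
    a b : Bool
    c c′ : Colour
    x y z : Part
    π π′ λs : List Part

¬T⇒≡false : ¬ T a → a ≡ false
¬T⇒≡false {false} _ = refl
¬T⇒≡false {true} ¬t = ⊥-elim (¬t _)

T-∧₃ : ∀ {a b d} → T (a ∧ b ∧ d) → T a × T b × T d
T-∧₃ t with to T-∧ t
... | ta , tbd = ta , to T-∧ tbd

data Gap (p : ℕ) : ℕ → Set where
  same : Gap p p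
  next : Gap p (p + 1)
  wide : ∀ u → 2 ≤ u → Gap p (p + u)

gap : p ≤ q → Gap p q
gap {p} {q} p≤q with q ∸ p | m+[n∸m]≡n p≤q
... | 0           | refl = subst (Gap p) (sym (+-identityʳ p)) same
... | 1           | refl = next
... | suc (suc u) | refl = wide (suc (suc u)) (s≤s (s≤s z≤n))

m+n≤m⇒n≡0 : ∀ m {n} → m + n ≤ m → n ≡ 0
m+n≤m⇒n≡0 m {n} h = n≤0⇒n≡0 (+-cancelˡ-≤ m n 0 (subst (m + n ≤_) (sym (+-identityʳ m)) h))

χ∸χ≡1 : T a → ¬ T b → χ a ∸ χ b ≡ 1
χ∸χ≡1 {true} {false} _ _ = refl
χ∸χ≡1 {true} {true} _ ¬b = ⊥-elim (¬b _)

χ∸χ≡0 : (T a → T b) → χ a ∸ χ b ≡ 0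
χ∸χ≡0 {false} {false} _ = refl
χ∸χ≡0 {false} {true} _ = refl
χ∸χ≡0 {true} {true} _ = refl
χ∸χ≡0 {true} {false} a⇒b = ⊥-elim (a⇒b _)

χ∸χ≡0⇒ : χ a ∸ χ b ≡ 0 → T a → T b
χ∸χ≡0⇒ {true} {true} _ _ = _

-- Δ (i , k) (i′ , k′) is by definition  jump i′ i i k i′ + jump k k′ k i′ k′.
jump : ℕ → ℕ → ℕ → ℕ → ℕ → ℕ
jump m n u v w = χ (m ≤ᵇ n) ∸ χ ((u ≡ᵇ v) ∧ (v ≡ᵇ w))

T-chain⇒ : T ((u ≡ᵇ v) ∧ (v ≡ᵇ w)) → u ≡ v × v ≡ w
T-chain⇒ {u} {v} {w} t with to T-∧ t
... | e₁ , e₂ = ≡ᵇ⇒≡ u v e₁ , ≡ᵇ⇒≡ v w e₂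

chain⇒T : u ≡ v × v ≡ w → T ((u ≡ᵇ v) ∧ (v ≡ᵇ w))
chain⇒T {u} (refl , refl) = Equivalence.from T-∧ (≡⇒≡ᵇ u u refl , ≡⇒≡ᵇ u u refl)

jump≡1 : m ≤ n → ¬ (u ≡ v × v ≡ w) → jump m n u v w ≡ 1
jump≡1 m≤n ¬chain = χ∸χ≡1 (≤⇒≤ᵇ m≤n) (¬chain ∘ T-chain⇒)

jump≡0 : (m ≤ n → u ≡ v × v ≡ w) → jump m n u v w ≡ 0
jump≡0 {m} {n} f = χ∸χ≡0 (chain⇒T ∘ f ∘ ≤ᵇ⇒≤ m n)

jump≡0⇒ : jump m n u v w ≡ 0 → m ≤ n → u ≡ v × v ≡ w
jump≡0⇒ e = T-chain⇒ ∘ χ∸χ≡0⇒ e ∘ ≤⇒≤ᵇ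

Δ≡0 : ∀ {i k i′ k′} → (i′ ≤ i → i ≡ k × k ≡ i′) → (k ≤ k′ → k ≡ i′ × i′ ≡ k′) →
      Δ (i , k) (i′ , k′) ≡ 0
Δ≡0 {i} {k} {i′} {k′} f g =
  cong₂ _+_ (jump≡0 {i′} {i} {i} {k} {i′} f) (jump≡0 {k} {k′} {k} {i′} {k′} g)

Δ≡0⇒ : ∀ {i k i′ k′} → Δ (i , k) (i′ , k′) ≡ 0 →
       (i′ ≤ i → i ≡ k × k ≡ i′) × (k ≤ k′ → k ≡ i′ × i′ ≡ k′)
Δ≡0⇒ {i} {k} {i′} {k′} e =
  jump≡0⇒ {i′} {i} {i} {k} {i′} (m+n≡0⇒m≡0 _ e) , jump≡0⇒ {k} {k′} {k} {i′} {k′} (m+n≡0⇒n≡0 _ e)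

Δ≡2 : ∀ {i k i′ k′} → i′ ≤ i → ¬ (i ≡ k × k ≡ i′) → k ≤ k′ → ¬ (k ≡ i′ × i′ ≡ k′) →
      Δ (i , k) (i′ , k′) ≡ 2
Δ≡2 {i} {k} {i′} {k′} i′≤i ¬f k≤k′ ¬g =
  cong₂ _+_ (jump≡1 {i′} {i} {i} {k} {i′} i′≤i ¬f) (jump≡1 {k} {k′} {k} {i′} {k′} k≤k′ ¬g)

Δ-to-free≡0 : Δ (i , j) (free k) ≡ 0 → (i ≡ k × j ≡ k) ⊎ (i < k × k ≤ j)
Δ-to-free≡0 {i} {j} {k} e with Δ≡0⇒ e | k ≤? i
... | f , _ | yes k≤i = let (i≡j , j≡k) = f k≤i in inj₁ (trans i≡j j≡k , j≡k)
... | _ , g | no k≰i  = inj₂ (≰⇒> k≰i , ≮⇒≥ (λ j<k → <⇒≢ j<k (proj₁ (g (<⇒≤ j<k)))))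

Δ-from-free≡0 : Δ (free k) (k₂ , ℓ₂) ≡ 0 → (k₂ ≡ k × ℓ₂ ≡ k) ⊎ (ℓ₂ < k × k ≤ k₂)
Δ-from-free≡0 {k} {k₂} {ℓ₂} e with Δ≡0⇒ e | k ≤? ℓ₂
... | _ , g | yes k≤ℓ₂ = let (k≡k₂ , k₂≡ℓ₂) = g k≤ℓ₂ in inj₁ (sym k≡k₂ , trans (sym k₂≡ℓ₂) (sym k≡k₂))
... | f , _ | no k≰ℓ₂  = inj₂ (≰⇒> k≰ℓ₂ , ≮⇒≥ (λ k₂<k → <⇒≢ k₂<k (sym (proj₂ (f (<⇒≤ k₂<k))))))

Δ-to-free≤1 : j < i → Δ (i , j) (free k) ≤ 1 → ¬ (j < k × k ≤ i)
Δ-to-free≤1 j<i Δ≤1 (j<k , k≤i) = <⇒≱ (n<1+n 1) (subst (_≤ 1) Δ≡2-here Δ≤1)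
  where
  Δ≡2-here = Δ≡2 k≤i (λ (i≡j , _) → <⇒≢ j<i (sym i≡j)) (<⇒≤ j<k) (λ (j≡k , _) → <⇒≢ j<k j≡k)

Δ-from-free≤1 : k₂ < ℓ₂ → Δ (free k) (k₂ , ℓ₂) ≤ 1 → ¬ (k₂ < k × k ≤ ℓ₂)
Δ-from-free≤1 k₂<ℓ₂ Δ≤1 (k₂<k , k≤ℓ₂) = <⇒≱ (n<1+n 1) (subst (_≤ 1) Δ≡2-here Δ≤1)
  where
  Δ≡2-here = Δ≡2 (<⇒≤ k₂<k) (λ (_ , k≡k₂) → <⇒≢ k₂<k (sym k≡k₂))
                 k≤ℓ₂ (λ (k≡k₂ , _) → <⇒≢ k₂<k (sym k≡k₂))

data Raised : Colour → Colour → Set where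
  free-free  : 0 < i → Raised (free i) (free i)
  free-bound : ℓ < k → Raised (free k) (k , ℓ)
  bound-free : k < ℓ → Raised (k , ℓ) (free ℓ)

Raised⇒Δ≡0 : Raised c c′ → Δ c c′ ≡ 0
Raised⇒Δ≡0 (free-free {i} _) = Δ≡0 {i} {i} {i} {i} (λ _ → refl , refl) (λ _ → refl , refl)
Raised⇒Δ≡0 (free-bound {ℓ} {k} ℓ<k) =
  Δ≡0 {k} {k} {k} {ℓ} (λ _ → refl , refl) (λ k≤ℓ → ⊥-elim (<⇒≱ ℓ<k k≤ℓ))
Raised⇒Δ≡0 (bound-free {k} {ℓ} k<ℓ) =
  Δ≡0 {k} {ℓ} {ℓ} {ℓ} (λ ℓ≤k → ⊥-elim (<⇒≱ k<ℓ ℓ≤k)) (λ _ → refl , refl)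

Raised⇒Δ₂≡1 : Raised c c′ → Δ₂ c c′ ≡ 1
Raised⇒Δ₂≡1 (free-free {i} 0<i)
  rewrite to T-≡ (≡⇒≡ᵇ i i refl) | to T-≡ (<⇒<ᵇ 0<i) = refl
Raised⇒Δ₂≡1 (free-bound {ℓ} {k} ℓ<k)
  rewrite to T-≡ (≡⇒≡ᵇ k k refl) | ¬T⇒≡false (<⇒≢ ℓ<k ∘ ≡ᵇ⇒≡ ℓ k)
        | to T-≡ (<⇒<ᵇ ℓ<k) = refl
Raised⇒Δ₂≡1 (bound-free {k} {ℓ} k<ℓ)
  rewrite ¬T⇒≡false (<⇒≢ k<ℓ ∘ ≡ᵇ⇒≡ k ℓ) | to T-≡ (≡⇒≡ᵇ ℓ ℓ refl)
        | to T-≡ (<⇒<ᵇ k<ℓ) = refl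

raised₁ : ∀ {i k i′ k′} → T ((i ≡ᵇ k) ∧ (i′ ≡ᵇ i) ∧ (k′ ≡ᵇ i) ∧ (0 <ᵇ i)) → Raised (i , k) (i′ , k′)
raised₁ {i} {k} {i′} {k′} t with T-∧₃ t
... | i≡k , i′≡i , t′ with to T-∧ t′
... | k′≡i , 0<i with ≡ᵇ⇒≡ i k i≡k | ≡ᵇ⇒≡ i′ i i′≡i | ≡ᵇ⇒≡ k′ i k′≡i
... | refl | refl | refl = free-free (<ᵇ⇒< 0 i 0<i)

raised₂ : ∀ {i k i′ k′} → T ((i ≡ᵇ k) ∧ (i′ ≡ᵇ k) ∧ (k′ <ᵇ k)) → Raised (i , k) (i′ , k′)
raised₂ {i} {k} {i′} {k′} t with T-∧₃ t
... | i≡k , i′≡k , k′<k with ≡ᵇ⇒≡ i k i≡k | ≡ᵇ⇒≡ i′ k i′≡k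
... | refl | refl = free-bound (<ᵇ⇒< k′ k k′<k)

raised₃ : ∀ {i k i′ k′} → T ((i′ ≡ᵇ k′) ∧ (k ≡ᵇ k′) ∧ (i <ᵇ k)) → Raised (i , k) (i′ , k′)
raised₃ {i} {k} {i′} {k′} t with T-∧₃ t
... | i′≡k′ , k≡k′ , i<k with ≡ᵇ⇒≡ i′ k′ i′≡k′ | ≡ᵇ⇒≡ k k′ k≡k′
... | refl | refl = bound-free (<ᵇ⇒< i k i<k)

Δ₂≡Δ⊎Raised : ∀ c c′ → Δ₂ c c′ ≡ Δ c c′ ⊎ Raised c c′
Δ₂≡Δ⊎Raised (i , k) (i′ , k′) with (i ≡ᵇ k) ∧ (i′ ≡ᵇ i) ∧ (k′ ≡ᵇ i) ∧ (0 <ᵇ i) in e₁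
... | true  = inj₂ (raised₁ (Equivalence.from T-≡ e₁))
... | false with (i ≡ᵇ k) ∧ (i′ ≡ᵇ k) ∧ (k′ <ᵇ k) in e₂
...   | true  = inj₂ (raised₂ (Equivalence.from T-≡ e₂))
...   | false with (i′ ≡ᵇ k′) ∧ (k ≡ᵇ k′) ∧ (i <ᵇ k) in e₃
...     | true  = inj₂ (raised₃ (Equivalence.from T-≡ e₃))
...     | false = inj₁ refl

Δ≤Δ₂ : ∀ c c′ → Δ c c′ ≤ Δ₂ c c′
Δ≤Δ₂ c c′ with Δ₂≡Δ⊎Raised c c′
... | inj₁ Δ₂≡Δ = ≤-reflexive (sym Δ₂≡Δ)
... | inj₂ raised rewrite Raised⇒Δ≡0 raised = z≤n

δ₂-descending : ℓ < k → δ₂ (k , ℓ) ≡ k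
δ₂-descending = m≥n⇒m⊔n≡m ∘ <⇒≤

δ₂-ascending : k < ℓ → δ₂ (k , ℓ) ≡ ℓ
δ₂-ascending = m≤n⇒m⊔n≡n ∘ <⇒≤

γ₂-nested : ∀ {k₁ ℓ₁ k₂ ℓ₂} → k₁ ⊔ ℓ₂ < k₂ ⊓ ℓ₁ → γ₂ (k₁ , ℓ₁) (k₂ , ℓ₂) ≡ k₂ ⊓ ℓ₁
γ₂-nested h rewrite to T-≡ (<⇒<ᵇ h) = refl

raised-nested : ∀ {k₁ ℓ₁ k₂ ℓ₂} → k₁ ⊔ ℓ₂ < k₂ ⊓ ℓ₁ →
  Raised (k₁ , ℓ₁) (free (k₂ ⊓ ℓ₁)) ⊎ Raised (free (k₂ ⊓ ℓ₁)) (k₂ , ℓ₂)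
raised-nested {k₁} {ℓ₁} {k₂} {ℓ₂} h with ≤-total k₂ ℓ₁
... | inj₁ k₂≤ℓ₁ rewrite m≤n⇒m⊓n≡m k₂≤ℓ₁ =
  inj₂ (free-bound (≤-<-trans (m≤n⊔m k₁ ℓ₂) h))
... | inj₂ ℓ₁≤k₂ rewrite m≥n⇒m⊓n≡n ℓ₁≤k₂ =
  inj₁ (bound-free (≤-<-trans (m≤m⊔n k₁ ℓ₂) h))

T-<ᵇ∧≤ᵇ⇒ : T ((m <ᵇ n) ∧ (n ≤ᵇ u)) → m < n × n ≤ u
T-<ᵇ∧≤ᵇ⇒ {m} {n} {u} t with to T-∧ t
... | m<n , n≤u = <ᵇ⇒< m n m<n , ≤ᵇ⇒≤ n u n≤u

not-nested-descending : ∀ {k₁ ℓ₁ k₂ ℓ₂} → ℓ₁ < k₁ → ¬ (k₁ ⊔ ℓ₂ < k₂ ⊓ ℓ₁)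
not-nested-descending {k₁} {ℓ₁} {k₂} {ℓ₂} ℓ₁<k₁ h =
  n≮n k₁ (≤-<-trans (m≤m⊔n k₁ ℓ₂) (<-≤-trans h (≤-trans (m⊓n≤n k₂ ℓ₁) (<⇒≤ ℓ₁<k₁))))

not-nested-ascending : ∀ {k₁ ℓ₁ k₂ ℓ₂} → k₂ < ℓ₂ → ¬ (k₁ ⊔ ℓ₂ < k₂ ⊓ ℓ₁)
not-nested-ascending {k₁} {ℓ₁} {k₂} {ℓ₂} k₂<ℓ₂ h =
  n≮n ℓ₂ (≤-<-trans (m≤n⊔m k₁ ℓ₂) (<-≤-trans h (≤-trans (m⊓n≤m k₂ ℓ₁) (<⇒≤ k₂<ℓ₂))))

γ₂-k₂∈D : ∀ {k₁ ℓ₁ k₂ ℓ₂} → ℓ₁ < k₁ → ℓ₂ < k₂ → ¬ (ℓ₁ < k₂ × k₂ ≤ k₁) → γ₂ (k₁ , ℓ₁) (k₂ , ℓ₂) ≡ k₂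
γ₂-k₂∈D {k₁} {ℓ₁} {k₂} {ℓ₂} ℓ₁<k₁ ℓ₂<k₂ k₂∈D
  rewrite ¬T⇒≡false (not-nested-descending {k₂ = k₂} {ℓ₂} ℓ₁<k₁ ∘ <ᵇ⇒< _ _)
        | to T-≡ (<⇒<ᵇ ℓ₁<k₁) | to T-≡ (<⇒<ᵇ ℓ₂<k₂)
        | ¬T⇒≡false (k₂∈D ∘ T-<ᵇ∧≤ᵇ⇒ {ℓ₁} {k₂} {k₁}) = refl

γ₂-k₂∉D : ∀ {k₁ ℓ₁ k₂ ℓ₂} → ℓ₁ < k₁ → ℓ₂ < k₂ → ℓ₁ < k₂ → k₂ ≤ k₁ → γ₂ (k₁ , ℓ₁) (k₂ , ℓ₂) ≡ suc ℓ₂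
γ₂-k₂∉D {k₁} {ℓ₁} {k₂} {ℓ₂} ℓ₁<k₁ ℓ₂<k₂ ℓ₁<k₂ k₂≤k₁
  rewrite ¬T⇒≡false (not-nested-descending {k₂ = k₂} {ℓ₂} ℓ₁<k₁ ∘ <ᵇ⇒< _ _)
        | to T-≡ (<⇒<ᵇ ℓ₁<k₁) | to T-≡ (<⇒<ᵇ ℓ₂<k₂)
        | to T-≡ (<⇒<ᵇ ℓ₁<k₂) | to T-≡ (≤⇒≤ᵇ k₂≤k₁) = refl

γ₂-ℓ₁∈E : ∀ {k₁ ℓ₁ k₂ ℓ₂} → k₁ < ℓ₁ → k₂ < ℓ₂ → ¬ (k₂ < ℓ₁ × ℓ₁ ≤ ℓ₂) → γ₂ (k₁ , ℓ₁) (k₂ , ℓ₂) ≡ ℓ₁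
γ₂-ℓ₁∈E {k₁} {ℓ₁} {k₂} {ℓ₂} k₁<ℓ₁ k₂<ℓ₂ ℓ₁∈E
  rewrite ¬T⇒≡false (not-nested-ascending {k₁} {ℓ₁} k₂<ℓ₂ ∘ <ᵇ⇒< _ _)
        | ¬T⇒≡false (<⇒≯ k₁<ℓ₁ ∘ <ᵇ⇒< ℓ₁ k₁)
        | to T-≡ (<⇒<ᵇ k₁<ℓ₁) | to T-≡ (<⇒<ᵇ k₂<ℓ₂)
        | ¬T⇒≡false (ℓ₁∈E ∘ T-<ᵇ∧≤ᵇ⇒ {k₂} {ℓ₁} {ℓ₂}) = refl

γ₂-ℓ₁∉E : ∀ {k₁ ℓ₁ k₂ ℓ₂} → k₁ < ℓ₁ → k₂ < ℓ₂ → k₂ < ℓ₁ → ℓ₁ ≤ ℓ₂ → γ₂ (k₁ , ℓ₁) (k₂ , ℓ₂) ≡ suc k₁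
γ₂-ℓ₁∉E {k₁} {ℓ₁} {k₂} {ℓ₂} k₁<ℓ₁ k₂<ℓ₂ k₂<ℓ₁ ℓ₁≤ℓ₂
  rewrite ¬T⇒≡false (not-nested-ascending {k₁} {ℓ₁} k₂<ℓ₂ ∘ <ᵇ⇒< _ _)
        | ¬T⇒≡false (<⇒≯ k₁<ℓ₁ ∘ <ᵇ⇒< ℓ₁ k₁)
        | to T-≡ (<⇒<ᵇ k₁<ℓ₁) | to T-≡ (<⇒<ᵇ k₂<ℓ₂)
        | to T-≡ (<⇒<ᵇ k₂<ℓ₁) | to T-≡ (≤⇒≤ᵇ ℓ₁≤ℓ₂) = refl

DNonEmpty⇒ℓ₂<ℓ₁ : k₂ ≤ k₁ → DNonEmpty k₁ ℓ₁ k₂ ℓ₂ → ℓ₂ < ℓ₁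
DNonEmpty⇒ℓ₂<ℓ₁ k₂≤k₁ (j , ℓ₂<j , j≤k₂ , j∉) =
  <-≤-trans ℓ₂<j (≮⇒≥ (λ ℓ₁<j → j∉ (ℓ₁<j , ≤-trans j≤k₂ k₂≤k₁)))

ENonEmpty⇒k₁<k₂ : ℓ₁ ≤ ℓ₂ → ENonEmpty k₁ ℓ₁ k₂ ℓ₂ → k₁ < k₂
ENonEmpty⇒k₁<k₂ ℓ₁≤ℓ₂ (j , k₁<j , j≤ℓ₁ , j∉) =
  <-≤-trans k₁<j (≮⇒≥ (λ k₂<j → j∉ (k₂<j , ≤-trans j≤ℓ₁ ℓ₁≤ℓ₂)))

BeginsWith⇒Contains : BeginsWith λs π → Contains λs π
BeginsWith⇒Contains (ys , e) = [] , ys , e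

EndsWith⇒Contains : EndsWith λs π → Contains λs π
EndsWith⇒Contains {π = π} (xs , e) = xs , [] , trans e (cong (xs ++_) (sym (++-identityʳ π)))

Contains-++⁻ˡ : ∀ π → Contains λs (π ++ π′) → Contains λs π
Contains-++⁻ˡ {π′ = π′} π (xs , ys , e) = xs , π′ ++ ys , trans e (cong (xs ++_) (++-assoc π π′ ys))

Contains-∷⁻ : Contains λs (x ∷ π) → Contains λs π
Contains-∷⁻ {x = x} (xs , ys , e) = xs ++ x ∷ [] , ys , trans e (sym (++-assoc xs (x ∷ []) _))

Contains-free-cong : g ≡ g′ → Contains λs (x ∷ (p , free g) ∷ z ∷ []) →
                     Contains λs (x ∷ (p , free g′) ∷ z ∷ [])
Contains-free-cong refl h = h

Contains-extendˡ : Contains λs π → BeginsWith λs π ⊎ ∃[ x ] Contains λs (x ∷ π)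
Contains-extendˡ (xs , ys , e) with initLast xs
... | []       = inj₁ (ys , e)
... | zs ∷ʳ′ x = inj₂ (x , zs , ys , trans e (++-assoc zs (x ∷ []) _))

Contains-extendʳ : Contains λs π → EndsWith λs π ⊎ ∃[ z ] Contains λs (π ++ z ∷ [])
Contains-extendʳ {π = π} (xs , [] , e) = inj₁ (xs , trans e (cong (xs ++_) (++-identityʳ π)))
Contains-extendʳ {π = π} (xs , z ∷ ys , e) =
  inj₂ (z , xs , ys , trans e (cong (xs ++_) (sym (++-assoc π (z ∷ []) ys))))

Contains-All : ∀ {P : Part → Set} → All P λs → Contains λs π → All P π
Contains-All {π = π} a (xs , ys , refl) = ++⁻ˡ π (++⁻ʳ xs a)

Contains-Linked : ∀ {R : Part → Part → Set} → Linked R λs → Contains λs (x ∷ y ∷ []) → R x y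
Contains-Linked {x = x} {y} {R} l (xs , ys , refl) = go xs l
  where
  go : ∀ xs → Linked R (xs ++ x ∷ y ∷ ys) → R x y
  go []       l = Linked.head l
  go (_ ∷ xs) l = go xs (Linked.tail l)

Linked-fromContains : ∀ {R : Part → Part → Set} λs →
  (∀ {x y} → Contains λs (x ∷ y ∷ []) → R x y) → Linked R λs
Linked-fromContains []            _    = []
Linked-fromContains (_ ∷ [])      _    = [-]
Linked-fromContains (x ∷ y ∷ λs) pair =
  pair ([] , λs , refl) ∷
  Linked-fromContains (y ∷ λs) (λ (xs , ys , e) → pair (x ∷ xs , ys , cong (x ∷_) e))

-- From the right-hand side to 𝒞_n(δ₂, γ₂)

AvoidR₁ : List Part → Set
AvoidR₁ λs = ∀ p k₁ ℓ₁ k₂ ℓ₂ → 1 ≤ p → ℓ₂ < ℓ₁ → ℓ₁ < k₂ → k₂ ≤ k₁ →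
  ¬ Contains λs ((p + 1 , (k₁ , ℓ₁)) ∷ (p , free (suc ℓ₂)) ∷ (p , (k₂ , ℓ₂)) ∷ [])

AvoidR₂ : List Part → Set
AvoidR₂ λs = ∀ p k₁ ℓ₁ k₂ ℓ₂ → 1 ≤ p → k₁ < k₂ → k₂ < ℓ₁ → ℓ₁ ≤ ℓ₂ →
  ¬ Contains λs ((p + 1 , (k₁ , ℓ₁)) ∷ (p + 1 , free (suc k₁)) ∷ (p , (k₂ , ℓ₂)) ∷ [])

module FromRHS {n : ℕ} {λs : List Part} (linked : Linked (DiffCond Δ₂) λs) (noR₁ : AvoidR₁ λs) (noR₂ : AvoidR₂ λs) where

  no-pair : Raised c c′ → ¬ Contains λs ((p , c) ∷ (p , c′) ∷ [])
  no-pair {p = p} raised h =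
    m+1+n≰m p (subst (λ d → p + d ≤ p) (Raised⇒Δ₂≡1 raised) (Contains-Linked linked h))

  no-pair-left : Raised c c′ → ¬ Contains λs ((p , c) ∷ (p , c′) ∷ z ∷ [])
  no-pair-left raised = no-pair raised ∘ Contains-++⁻ˡ (_ ∷ _ ∷ [])

  no-pair-right : Raised c c′ → ¬ Contains λs (x ∷ (p , c) ∷ (p , c′) ∷ [])
  no-pair-right raised = no-pair raised ∘ Contains-∷⁻

  raised-δ₂-descending : ℓ < k → Raised (free (δ₂ (k , ℓ))) (k , ℓ)
  raised-δ₂-descending ℓ<k rewrite δ₂-descending ℓ<k = free-bound ℓ<k

  raised-δ₂-ascending : k < ℓ → Raised (k , ℓ) (free (δ₂ (k , ℓ)))
  raised-δ₂-ascending k<ℓ rewrite δ₂-ascending k<ℓ = bound-free k<ℓ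

  avoidA : AvoidA n δ₂ γ₂ λs
  avoidA _ _ _ 0<i _ = no-pair (free-free 0<i)

  avoidB : AvoidB n δ₂ γ₂ λs
  avoidB _ k₁ _ _ ℓ₂ _ nested h with raised-nested {k₁ = k₁} {ℓ₂ = ℓ₂} nested
  ... | inj₁ raised = no-pair-left raised (Contains-free-cong (γ₂-nested {k₁ = k₁} {ℓ₂ = ℓ₂} nested) h)
  ... | inj₂ raised = no-pair-right raised (Contains-free-cong (γ₂-nested {k₁ = k₁} {ℓ₂ = ℓ₂} nested) h)

  avoidC1 : AvoidC1 n δ₂ γ₂ λs
  avoidC1 _ _ _ _ ℓ₂<k₂ =
    (λ _ _ _ _ → no-pair-right (raised-δ₂-descending ℓ₂<k₂)) ,
    no-pair (raised-δ₂-descending ℓ₂<k₂) ∘ BeginsWith⇒Contains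

  avoidC2 : AvoidC2 n δ₂ γ₂ λs
  avoidC2 _ _ _ _ _ _ ℓ₂<k₂ _ = no-pair-right (raised-δ₂-descending ℓ₂<k₂)

  avoidC3 : AvoidC3 n δ₂ γ₂ λs
  avoidC3 p k₁ ℓ₁ k₂ ℓ₂ 1≤p ℓ₂<k₂ ℓ₁<k₁ D h with ℓ₁ <? k₂ | k₂ ≤? k₁
  ... | yes ℓ₁<k₂ | yes k₂≤k₁ =
    noR₁ p k₁ ℓ₁ k₂ ℓ₂ 1≤p (DNonEmpty⇒ℓ₂<ℓ₁ k₂≤k₁ D) ℓ₁<k₂ k₂≤k₁
      (Contains-free-cong (γ₂-k₂∉D ℓ₁<k₁ ℓ₂<k₂ ℓ₁<k₂ k₂≤k₁) h)
  ... | no ℓ₁≮k₂ | _ =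
    no-pair-right (free-bound ℓ₂<k₂) (Contains-free-cong (γ₂-k₂∈D ℓ₁<k₁ ℓ₂<k₂ (ℓ₁≮k₂ ∘ proj₁)) h)
  ... | yes _ | no k₂≰k₁ =
    no-pair-right (free-bound ℓ₂<k₂) (Contains-free-cong (γ₂-k₂∈D ℓ₁<k₁ ℓ₂<k₂ (k₂≰k₁ ∘ proj₂)) h)

  avoidD1 : AvoidD1 n δ₂ γ₂ λs
  avoidD1 _ _ _ _ k₁<ℓ₁ =
    (λ _ _ _ _ _ _ → no-pair-left (raised-δ₂-ascending k₁<ℓ₁)) ,
    no-pair (raised-δ₂-ascending k₁<ℓ₁) ∘ EndsWith⇒Contains

  avoidD2 : AvoidD2 n δ₂ γ₂ λs
  avoidD2 _ _ _ _ _ _ k₁<ℓ₁ _ = no-pair-left (raised-δ₂-ascending k₁<ℓ₁)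

  avoidD3 : AvoidD3 n δ₂ γ₂ λs
  avoidD3 p k₁ ℓ₁ k₂ ℓ₂ 1≤p k₁<ℓ₁ k₂<ℓ₂ E h with k₂ <? ℓ₁ | ℓ₁ ≤? ℓ₂
  ... | yes k₂<ℓ₁ | yes ℓ₁≤ℓ₂ =
    noR₂ p k₁ ℓ₁ k₂ ℓ₂ 1≤p (ENonEmpty⇒k₁<k₂ ℓ₁≤ℓ₂ E) k₂<ℓ₁ ℓ₁≤ℓ₂
      (Contains-free-cong (γ₂-ℓ₁∉E k₁<ℓ₁ k₂<ℓ₂ k₂<ℓ₁ ℓ₁≤ℓ₂) h)
  ... | no k₂≮ℓ₁ | _ =
    no-pair-left (bound-free k₁<ℓ₁) (Contains-free-cong (γ₂-ℓ₁∈E k₁<ℓ₁ k₂<ℓ₂ (k₂≮ℓ₁ ∘ proj₁)) h)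
  ... | yes _ | no ℓ₁≰ℓ₂ =
    no-pair-left (bound-free k₁<ℓ₁) (Contains-free-cong (γ₂-ℓ₁∈E k₁<ℓ₁ k₂<ℓ₂ (ℓ₁≰ℓ₂ ∘ proj₂)) h)

InRHS⇒InC : InRHS n λs → InC n δ₂ γ₂ λs
InRHS⇒InC {n} (valid , notZeroZero , linked , noR₁ , noR₂) =
  (valid , Linked.map (λ {x} {y} → Δ₂⇒Δ {x} {y}) linked) , notZeroZero ,
  avoidA , avoidB , avoidC1 , avoidC2 , avoidC3 , avoidD1 , avoidD2 , avoidD3
  where
  open FromRHS {n} linked noR₁ noR₂
  Δ₂⇒Δ : DiffCond Δ₂ x y → DiffCond Δ x y
  Δ₂⇒Δ {x} {y} = ≤-trans (+-monoʳ-≤ (size y) (Δ≤Δ₂ (col x) (col y)))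

-- From 𝒞_n(δ₂, γ₂) to the right-hand side

module FromC {n : ℕ} {λs : List Part}
  (valid : All (ValidPart n) λs) (linked : Linked (DiffCond Δ) λs)
  (avoidA : AvoidA n δ₂ γ₂ λs) (avoidB : AvoidB n δ₂ γ₂ λs)
  (avoidC1 : AvoidC1 n δ₂ γ₂ λs) (avoidC2 : AvoidC2 n δ₂ γ₂ λs) (avoidC3 : AvoidC3 n δ₂ γ₂ λs)
  (avoidD1 : AvoidD1 n δ₂ γ₂ λs) (avoidD2 : AvoidD2 n δ₂ γ₂ λs) (avoidD3 : AvoidD3 n δ₂ γ₂ λs)
  where

  size≥1 : Contains λs ((p , c) ∷ π) → 1 ≤ p
  size≥1 h with Contains-All valid h
  ... | (1≤p , _) ∷ _ = 1≤p

  diff₁ : Contains λs (x ∷ y ∷ z ∷ []) → DiffCond Δ x y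
  diff₁ = Contains-Linked linked ∘ Contains-++⁻ˡ (_ ∷ _ ∷ [])

  diff₂ : Contains λs (x ∷ y ∷ z ∷ []) → DiffCond Δ y z
  diff₂ = Contains-Linked linked ∘ Contains-∷⁻

  no-equal-free-free : 0 < i → ¬ Contains λs ((p , free i) ∷ (p , free i) ∷ [])
  no-equal-free-free 0<i h with Contains-All valid h
  ... | (1≤p , i<n , _) ∷ _ = avoidA _ _ 1≤p 0<i i<n h

  avoidB-at : 1 ≤ p → k₁ ⊔ ℓ₂ < g → g ≡ k₂ ⊓ ℓ₁ →
    ¬ Contains λs ((p , (k₁ , ℓ₁)) ∷ (p , free g) ∷ (p , (k₂ , ℓ₂)) ∷ [])
  avoidB-at {k₁ = k₁} {ℓ₂ = ℓ₂} 1≤p nested refl =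
    avoidB _ _ _ _ _ 1≤p nested ∘ Contains-free-cong (sym (γ₂-nested {k₁ = k₁} {ℓ₂ = ℓ₂} nested))

  no-equal-free-bound-after : ∀ {p q i j k ℓ} → ℓ < k →
    ¬ Contains λs ((q , (i , j)) ∷ (p , free k) ∷ (p , (k , ℓ)) ∷ [])
  no-equal-free-bound-after {p} {q} {i} {j} {k} {ℓ} ℓ<k h
    with size≥1 (Contains-∷⁻ h) | gap (m+n≤o⇒m≤o p (diff₁ h))
  ... | 1≤p | same with Δ-to-free≡0 {i} {j} {k} (m+n≤m⇒n≡0 p (diff₁ h))
  ...   | inj₁ (refl , refl) = no-equal-free-free (≤-<-trans z≤n ℓ<k) (Contains-++⁻ˡ (_ ∷ _ ∷ []) h)
  ...   | inj₂ (i<k , k≤j)   = avoidB-at 1≤p (⊔-lub i<k ℓ<k) (sym (m≤n⇒m⊓n≡m k≤j)) h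
  no-equal-free-bound-after {p} {q} {i} {j} {k} {ℓ} ℓ<k h | 1≤p | next with i ≤? j
  ...   | yes i≤j = avoidC2 _ _ _ _ _ 1≤p ℓ<k i≤j (Contains-free-cong (sym (δ₂-descending ℓ<k)) h)
  ...   | no i≰j  = avoidC3 _ _ _ _ _ 1≤p ℓ<k j<i (k , ℓ<k , ≤-refl , k∈D)
                      (Contains-free-cong (sym (γ₂-k₂∈D j<i ℓ<k k∈D)) h)
    where
    j<i = ≰⇒> i≰j
    k∈D = Δ-to-free≤1 {k = k} j<i (+-cancelˡ-≤ p _ 1 (diff₁ h))
  no-equal-free-bound-after ℓ<k h | 1≤p | wide u 2≤u =
    proj₁ (avoidC1 _ _ _ 1≤p ℓ<k) u _ _ 2≤u (Contains-free-cong (sym (δ₂-descending ℓ<k)) h)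

  no-equal-bound-free-before : ∀ {p r i k k₂ ℓ₂} → i < k →
    ¬ Contains λs ((p , (i , k)) ∷ (p , free k) ∷ (r , (k₂ , ℓ₂)) ∷ [])
  no-equal-bound-free-before {p} {r} {i} {k} {k₂} {ℓ₂} i<k h
    with size≥1 h | size≥1 (Contains-∷⁻ (Contains-∷⁻ h)) | gap (m+n≤o⇒m≤o r (diff₂ h))
  ... | 1≤p | _ | same with Δ-from-free≡0 {k} {k₂} {ℓ₂} (m+n≤m⇒n≡0 r (diff₂ h))
  ...   | inj₁ (refl , refl) = no-equal-free-free (≤-<-trans z≤n i<k) (Contains-∷⁻ h)
  ...   | inj₂ (ℓ₂<k , k≤k₂) = avoidB-at 1≤p (⊔-lub i<k ℓ₂<k) (sym (m≥n⇒m⊓n≡n k≤k₂)) h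
  no-equal-bound-free-before {p} {r} {i} {k} {k₂} {ℓ₂} i<k h | _ | 1≤r | next with ℓ₂ ≤? k₂
  ...   | yes ℓ₂≤k₂ = avoidD2 _ _ _ _ _ 1≤r i<k ℓ₂≤k₂ (Contains-free-cong (sym (δ₂-ascending i<k)) h)
  ...   | no ℓ₂≰k₂  = avoidD3 _ _ _ _ _ 1≤r i<k k₂<ℓ₂ (k , i<k , ≤-refl , k∈E)
                        (Contains-free-cong (sym (γ₂-ℓ₁∈E i<k k₂<ℓ₂ k∈E)) h)
    where
    k₂<ℓ₂ = ≰⇒> ℓ₂≰k₂
    k∈E = Δ-from-free≤1 {k = k} k₂<ℓ₂ (+-cancelˡ-≤ r _ 1 (diff₂ h))
  no-equal-bound-free-before {r = r} i<k h | 1≤p | _ | wide u 2≤u =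
    proj₁ (avoidD1 _ _ _ 1≤p i<k) u r _ _ 2≤u refl (Contains-free-cong (sym (δ₂-ascending i<k)) h)

  no-equal-raised : Raised c c′ → ¬ Contains λs ((p , c) ∷ (p , c′) ∷ [])
  no-equal-raised (free-free 0<i) h = no-equal-free-free 0<i h
  no-equal-raised {p = p} (free-bound {ℓ} {k} ℓ<k) h with Contains-extendˡ h
  ... | inj₁ starts =
    proj₂ (avoidC1 _ _ _ (size≥1 h) ℓ<k)
      (subst (λ g → BeginsWith λs ((p , free g) ∷ (p , (k , ℓ)) ∷ [])) (sym (δ₂-descending ℓ<k)) starts)
  ... | inj₂ (_ , h′) = no-equal-free-bound-after ℓ<k h′
  no-equal-raised {p = p} (bound-free {i} {k} i<k) h with Contains-extendʳ h
  ... | inj₁ ends =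
    proj₂ (avoidD1 _ _ _ (size≥1 h) i<k)
      (subst (λ g → EndsWith λs ((p , (i , k)) ∷ (p , free g) ∷ [])) (sym (δ₂-ascending i<k)) ends)
  ... | inj₂ (_ , h′) = no-equal-bound-free-before i<k h′

  adjacent-DiffCond-Δ₂ : Contains λs (x ∷ y ∷ []) → DiffCond Δ₂ x y
  adjacent-DiffCond-Δ₂ {p , c} {q , c′} h with Δ₂≡Δ⊎Raised c c′
  ... | inj₁ Δ₂≡Δ = subst (λ d → q + d ≤ p) (sym Δ₂≡Δ) (Contains-Linked linked h)
  ... | inj₂ raised =
    subst (λ d → q + d ≤ p) (sym (Raised⇒Δ₂≡1 raised)) (subst (_≤ p) (+-comm 1 q) q<p)
    where
    q<p : q < p
    q<p = ≤∧≢⇒< (m+n≤o⇒m≤o q (Contains-Linked linked h)) (λ { refl → no-equal-raised raised h })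

  avoidR₁ : AvoidR₁ λs
  avoidR₁ p k₁ ℓ₁ k₂ ℓ₂ 1≤p ℓ₂<ℓ₁ ℓ₁<k₂ k₂≤k₁ =
    avoidC3 p k₁ ℓ₁ k₂ ℓ₂ 1≤p ℓ₂<k₂ ℓ₁<k₁ (suc ℓ₂ , ≤-refl , ℓ₂<k₂ , <⇒≱ ℓ₂<ℓ₁ ∘ s≤s⁻¹ ∘ proj₁)
    ∘ Contains-free-cong (sym (γ₂-k₂∉D ℓ₁<k₁ ℓ₂<k₂ ℓ₁<k₂ k₂≤k₁))
    where
    ℓ₂<k₂ = <-trans ℓ₂<ℓ₁ ℓ₁<k₂
    ℓ₁<k₁ = <-≤-trans ℓ₁<k₂ k₂≤k₁

  avoidR₂ : AvoidR₂ λs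
  avoidR₂ p k₁ ℓ₁ k₂ ℓ₂ 1≤p k₁<k₂ k₂<ℓ₁ ℓ₁≤ℓ₂ =
    avoidD3 p k₁ ℓ₁ k₂ ℓ₂ 1≤p k₁<ℓ₁ k₂<ℓ₂ (suc k₁ , ≤-refl , k₁<ℓ₁ , <⇒≱ k₁<k₂ ∘ s≤s⁻¹ ∘ proj₁)
    ∘ Contains-free-cong (sym (γ₂-ℓ₁∉E k₁<ℓ₁ k₂<ℓ₂ k₂<ℓ₁ ℓ₁≤ℓ₂))
    where
    k₁<ℓ₁ = <-trans k₁<k₂ k₂<ℓ₁
    k₂<ℓ₂ = <-≤-trans k₂<ℓ₁ ℓ₁≤ℓ₂

InC⇒InRHS : InC n δ₂ γ₂ λs → InRHS n λs
InC⇒InRHS {λs = λs} ((valid , linked) , notZeroZero , aA , aB , aC1 , aC2 , aC3 , aD1 , aD2 , aD3) =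
  valid , notZeroZero , Linked-fromContains λs adjacent-DiffCond-Δ₂ , avoidR₁ , avoidR₂
  where open FromC valid linked aA aB aC1 aC2 aC3 aD1 aD2 aD3

proposition1p23 : ∀ (n : ℕ) → 1 ≤ n → ∀ (λs : List Part) →
    InC n δ₂ γ₂ λs ⇔ InRHS n λs
proposition1p23 _ _ _ = mk⇔ InC⇒InRHS InRHS⇒InC
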